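{- Let $\Omega$ be a set with $|\Omega|=5$ and let $\mathcal{H}$ be a minimal domination completion of $\mathcal{U}_{3,\Omega}$. If $|A|=2$ for all $A\in\mathcal{H}$, then $\mathcal{H}=\mathcal{D}(G)$ for some graph $G$ with vertex set $\Omega$ isomorphic to the cycle $C_5$.
   Context: Graphs are finite, simple, undirected; $\mathcal{D}(G)$ is the family of inclusion-minimal dominating sets of $G$ (a dominating set is $D\subseteq V(G)$ such that every vertex outside $D$ has a neighbour in $D$). A hypergraph on $\Omega$ is a nonempty family of nonempty subsets of $\Omega$, none a proper subset of another; it has ground set $\Omega$ if the union of its members is $\Omega$. A domination hypergraph is one of the form $\mathcal{D}(G)$. $\mathcal{U}_{3,\Omega}=\{A\subseteq\Omega:|A|=3\}$. $\mathcal{H}_1\leqslant\mathcal{H}_2$ means: for every $A_1\in\mathcal{H}_1$ there is $A_2\in\mathcal{H}_2$ with $A_2\subseteq A_1$. A domination completion of $\mathcal{U}_{3,\Omega}$ is a domination hypergraph $\mathcal{H}$ with ground set $\Omega$ and $\mathcal{U}_{3,\Omega}\leqslant\mathcal{H}$; it is minimal if it is $\leqslant$-minimal among all domination completions. -}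

module Defs where

open import Data.Nat using (ℕ)
open import Data.Fin using (Fin; zero; suc)
open import Data.Fin.Subset using (Subset; _∈_; _∉_; _⊆_; ∣_∣; Nonempty)
open import Data.Fin.Permutation using (Permutation; _⟨$⟩ʳ_)
open import Data.Product using (Σ; ∃; _×_; _,_)
open import Function.Bundles using (_⇔_)
open import Relation.Binary.PropositionalEquality using (_≡_)
open import Relation.Nullary using (¬_)

record Graph (n : ℕ) : Set₁ where
  field
    Adj   : Fin n → Fin n → Set
    sym   : ∀ {u v} → Adj u v → Adj v u
    irrefl : ∀ {v} → ¬ Adj v v
open Graph public

Family : ℕ → Set₁
Family n = Subset n → Set

module _ {n : ℕ} where

  Dominating : Graph n → Subset n → Set
  Dominating G D = ∀ v → v ∉ D → ∃ λ u → u ∈ D × Adj G u v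

  MinDominating : Graph n → Subset n → Set
  MinDominating G D = Dominating G D × (∀ D′ → D′ ⊆ D → Dominating G D′ → D′ ≡ D)

  𝒟 : Graph n → Family n
  𝒟 G = MinDominating G

  _≋_ : Family n → Family n → Set
  H₁ ≋ H₂ = ∀ A → H₁ A ⇔ H₂ A

  IsHypergraph : Family n → Set
  IsHypergraph H = (∃ λ A → H A)
                 × (∀ A → H A → Nonempty A)
                 × (∀ A B → H A → H B → A ⊆ B → A ≡ B)

  HasGroundSet : Family n → Set
  HasGroundSet H = ∀ x → ∃ λ A → H A × x ∈ A

  IsDominationHypergraph : Family n → Set₁
  IsDominationHypergraph H = Σ (Graph n) λ G → H ≋ 𝒟 G

  _≤ₕ_ : Family n → Family n → Set
  H₁ ≤ₕ H₂ = ∀ A → H₁ A → ∃ λ B → H₂ B × B ⊆ A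

  𝒰₃ : Family n
  𝒰₃ A = ∣ A ∣ ≡ 3

  IsDominationCompletion : Family n → Set₁
  IsDominationCompletion H =
    IsHypergraph H × IsDominationHypergraph H × HasGroundSet H × (𝒰₃ ≤ₕ H)

  IsMinimalDominationCompletion : Family n → Set₁
  IsMinimalDominationCompletion H =
    IsDominationCompletion H
    × (∀ (H′ : Family n) → IsDominationCompletion H′ → H′ ≤ₕ H → H′ ≋ H)

  _≅_ : Graph n → Graph n → Set
  G₁ ≅ G₂ = Σ (Permutation n n) λ π →
    ∀ u v → Adj G₁ u v ⇔ Adj G₂ (π ⟨$⟩ʳ u) (π ⟨$⟩ʳ v)

next5 : Fin 5 → Fin 5
next5 zero = suc zero
next5 (suc zero) = suc (suc zero)
next5 (suc (suc zero)) = suc (suc (suc zero))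
next5 (suc (suc (suc zero))) = suc (suc (suc (suc zero)))
next5 (suc (suc (suc (suc zero)))) = zero

data C₅Adj : Fin 5 → Fin 5 → Set where
  fwd : ∀ u → C₅Adj u (next5 u)
  bwd : ∀ u → C₅Adj (next5 u) u

C₅-irrefl : ∀ {v} → ¬ C₅Adj v v
C₅-irrefl {zero} ()
C₅-irrefl {suc zero} ()
C₅-irrefl {suc (suc zero)} ()
C₅-irrefl {suc (suc (suc zero))} ()
C₅-irrefl {suc (suc (suc (suc zero)))} ()

C₅-sym : ∀ {u v} → C₅Adj u v → C₅Adj v u
C₅-sym (fwd u) = bwd u
C₅-sym (bwd u) = fwd u

C₅ : Graph 5
C₅ = record { Adj = C₅Adj ; sym = C₅-sym ; irrefl = C₅-irrefl }

-- A graph G with 𝒟 G = H has no dominating vertex u, since {u} would be a minimal dominating set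
-- of size one, and every pair that dominates G lies in H. Two questions about G and H always have
-- an answer: some pair inside any 3-set lies in H (as 𝒰₃ ≤ H and members of H have two elements),
-- and if {a, b} lies in H then every other vertex w is adjacent to a or to b. A finite decision
-- tree over these questions, found by computer search and checked by evaluation, shows that in
-- every branch the edges found either make some vertex adjacent to all others, which is
-- impossible, or put the five pairs {σ⁻¹ i, σ⁻¹ (i + 2)} of a relabelled C₅ into H. These pairs
-- are exactly the minimal dominating sets of that relabelled C₅, a domination completion below H,
-- so minimality of H gives H = 𝒟 (relabelled C₅).
module Submission where

open import Defs
open import Data.Fin.Subset using (∣_∣)
open import Data.Product using (Σ; _×_)
open import Relation.Binary.PropositionalEquality using (_≡_)

open import Data.Bool.Properties as Bool using ()
open import Data.Empty using (⊥-elim)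
open import Data.Fin using (Fin; zero; suc; #_)
open import Data.Fin.Permutation using (Permutation; _⟨$⟩ʳ_; _⟨$⟩ˡ_; permutation; inverseˡ)
open import Data.Fin.Properties using (_≟_; all?; any?)
open import Data.Fin.Subset using (Subset; _∈_; _∉_; _⊆_; ⁅_⁆; _∪_; ⊤; ⊥; Nonempty)
open import Data.Fin.Subset.Properties
  using ( _∈?_; _⊆?_; x∈⁅x⁆; x∈⁅y⁆⇒x≡y; ∣⁅x⁆∣≡1; ⊆-antisym; p⊆q⇒∣p∣≤∣q∣; x∈p∪q⁻; x∈p∪q⁺
        ; anySubset?; ∪-comm; ∉⊥; ∈⊤)
open import Data.Nat as ℕ using (ℕ; suc; _≤_; s≤s)
open import Data.Product using (∃; _,_; proj₁; proj₂)
open import Data.Sum using (_⊎_; inj₁; inj₂)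
open import Data.Unit using (tt)
open import Data.Vec using (Vec; []; _∷_; lookup; updateAt; replicate)
import Data.Vec.Properties as Vec
open import Function using (_∘_)
open import Function.Bundles using (Equivalence)
open import Function.Properties.Equivalence using () renaming (refl to ⇔-refl; sym to ⇔-sym)
open import Relation.Binary.Definitions using (DecidableEquality)
open import Relation.Binary.PropositionalEquality as ≡ using (refl; subst; subst₂)
open import Relation.Nullary using (¬_; Dec; yes; no)
open import Relation.Nullary.Decidable
  using (¬?; _×-dec_; _⊎-dec_; _→-dec_; map′; decidable-stable; True; toWitness)

private
  variable
    n : ℕ

pair : Fin n → Fin n → Subset n
pair a b = ⁅ a ⁆ ∪ ⁅ b ⁆

triple : Fin n → Fin n → Fin n → Subset n
triple x y z = ⁅ x ⁆ ∪ pair y z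

module _ {a b : Fin n} where

  ∈-pair⁻ : ∀ {v} → v ∈ pair a b → v ≡ a ⊎ v ≡ b
  ∈-pair⁻ v∈ with x∈p∪q⁻ ⁅ a ⁆ ⁅ b ⁆ v∈
  ... | inj₁ v∈a = inj₁ (x∈⁅y⁆⇒x≡y a v∈a)
  ... | inj₂ v∈b = inj₂ (x∈⁅y⁆⇒x≡y b v∈b)

  ∈-pairˡ : a ∈ pair a b
  ∈-pairˡ = x∈p∪q⁺ (inj₁ (x∈⁅x⁆ a))

  ∈-pairʳ : b ∈ pair a b
  ∈-pairʳ = x∈p∪q⁺ {p = ⁅ a ⁆} (inj₂ (x∈⁅x⁆ b))

  pair-comm : pair a b ≡ pair b a
  pair-comm = ∪-comm ⁅ a ⁆ ⁅ b ⁆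

  pair-⊆ : ∀ {A} → a ∈ A → b ∈ A → pair a b ⊆ A
  pair-⊆ {A} a∈A b∈A v∈ with ∈-pair⁻ v∈
  ... | inj₁ refl = a∈A
  ... | inj₂ refl = b∈A

  ⊆-pair-∌ˡ : ∀ {B} → a ∉ B → B ⊆ pair a b → B ⊆ ⁅ b ⁆
  ⊆-pair-∌ˡ a∉B B⊆ v∈ with ∈-pair⁻ (B⊆ v∈)
  ... | inj₁ refl = ⊥-elim (a∉B v∈)
  ... | inj₂ refl = x∈⁅x⁆ b

  ⊆-pair-∌ʳ : ∀ {B} → b ∉ B → B ⊆ pair a b → B ⊆ ⁅ a ⁆
  ⊆-pair-∌ʳ b∉B B⊆ v∈ with ∈-pair⁻ (B⊆ v∈)
  ... | inj₁ refl = x∈⁅x⁆ a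
  ... | inj₂ refl = ⊥-elim (b∉B v∈)

pair-self-⊆ : ∀ {a : Fin n} → pair a a ⊆ ⁅ a ⁆
pair-self-⊆ {a = a} v∈ with ∈-pair⁻ {a = a} {b = a} v∈
... | inj₁ refl = x∈⁅x⁆ a
... | inj₂ refl = x∈⁅x⁆ a

module _ {x y z : Fin n} where

  ∈-triple⁻ : ∀ {v} → v ∈ triple x y z → v ≡ x ⊎ v ≡ y ⊎ v ≡ z
  ∈-triple⁻ v∈ with x∈p∪q⁻ ⁅ x ⁆ (pair y z) v∈
  ... | inj₁ v∈x = inj₁ (x∈⁅y⁆⇒x≡y x v∈x)
  ... | inj₂ v∈yz = inj₂ (∈-pair⁻ v∈yz)

  triple-⊆ : ∀ {A} → x ∈ A → y ∈ A → z ∈ A → triple x y z ⊆ A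
  triple-⊆ x∈A y∈A z∈A v∈ with ∈-triple⁻ v∈
  ... | inj₁ refl = x∈A
  ... | inj₂ (inj₁ refl) = y∈A
  ... | inj₂ (inj₂ refl) = z∈A

  module _ {B : Subset n} (B⊆ : B ⊆ triple x y z) where

    ⊆-triple-∌ˡ : x ∉ B → B ⊆ pair y z
    ⊆-triple-∌ˡ x∉B v∈ with ∈-triple⁻ (B⊆ v∈)
    ... | inj₁ refl = ⊥-elim (x∉B v∈)
    ... | inj₂ (inj₁ refl) = ∈-pairˡ
    ... | inj₂ (inj₂ refl) = ∈-pairʳ

    ⊆-triple-∌ᵐ : y ∉ B → B ⊆ pair x z
    ⊆-triple-∌ᵐ y∉B v∈ with ∈-triple⁻ (B⊆ v∈)
    ... | inj₁ refl = ∈-pairˡ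
    ... | inj₂ (inj₁ refl) = ⊥-elim (y∉B v∈)
    ... | inj₂ (inj₂ refl) = ∈-pairʳ

    ⊆-triple-∌ʳ : z ∉ B → B ⊆ pair x y
    ⊆-triple-∌ʳ z∉B v∈ with ∈-triple⁻ (B⊆ v∈)
    ... | inj₁ refl = ∈-pairˡ
    ... | inj₂ (inj₁ refl) = ∈-pairʳ
    ... | inj₂ (inj₂ refl) = ⊥-elim (z∉B v∈)

∣∣≡2⇒⊈⁅⁆ : ∀ {B : Subset n} {x} → ∣ B ∣ ≡ 2 → ¬ B ⊆ ⁅ x ⁆
∣∣≡2⇒⊈⁅⁆ {B = B} {x} ∣B∣≡2 B⊆ with subst₂ _≤_ ∣B∣≡2 (∣⁅x⁆∣≡1 x) (p⊆q⇒∣p∣≤∣q∣ B⊆)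
... | s≤s ()

∣∣≡2∧⊆pair⇒≡ : ∀ {B : Subset n} {a b} → ∣ B ∣ ≡ 2 → B ⊆ pair a b → B ≡ pair a b
∣∣≡2∧⊆pair⇒≡ {B = B} {a} {b} ∣B∣≡2 B⊆ with a ∈? B | b ∈? B
... | yes a∈B | yes b∈B = ⊆-antisym B⊆ (pair-⊆ a∈B b∈B)
... | no a∉B  | _       = ⊥-elim (∣∣≡2⇒⊈⁅⁆ ∣B∣≡2 (⊆-pair-∌ˡ a∉B B⊆))
... | yes _   | no b∉B  = ⊥-elim (∣∣≡2⇒⊈⁅⁆ ∣B∣≡2 (⊆-pair-∌ʳ b∉B B⊆))

∣∣≡2∧⊆triple⇒pair : ∀ {B : Subset n} {x y z} →
                    ∣ triple x y z ∣ ≡ 3 → ∣ B ∣ ≡ 2 → B ⊆ triple x y z →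
                    B ≡ pair x y ⊎ B ≡ pair x z ⊎ B ≡ pair y z
∣∣≡2∧⊆triple⇒pair {B = B} {x} {y} {z} ∣xyz∣≡3 ∣B∣≡2 B⊆ with x ∈? B | y ∈? B | z ∈? B
... | _       | _       | no z∉B = inj₁ (∣∣≡2∧⊆pair⇒≡ ∣B∣≡2 (⊆-triple-∌ʳ B⊆ z∉B))
... | _       | no y∉B  | yes _  = inj₂ (inj₁ (∣∣≡2∧⊆pair⇒≡ ∣B∣≡2 (⊆-triple-∌ᵐ B⊆ y∉B)))
... | no x∉B  | yes _   | yes _  = inj₂ (inj₂ (∣∣≡2∧⊆pair⇒≡ ∣B∣≡2 (⊆-triple-∌ˡ B⊆ x∉B)))
... | yes x∈B | yes y∈B | yes z∈B
  with subst₂ _≤_ ∣xyz∣≡3 ∣B∣≡2 (p⊆q⇒∣p∣≤∣q∣ (triple-⊆ x∈B y∈B z∈B))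
... | s≤s (s≤s ())

infix 4 _≟ₛ_

_≟ₛ_ : DecidableEquality (Subset n)
_≟ₛ_ = Vec.≡-dec Bool._≟_

allSubsets? : {P : Subset n → Set} → (∀ A → Dec (P A)) → Dec (∀ A → P A)
allSubsets? P? with anySubset? (¬? ∘ P?)
... | yes (A , ¬PA) = no λ ∀P → ¬PA (∀P A)
... | no ∄¬P = yes λ A → decidable-stable (P? A) λ ¬PA → ∄¬P (A , ¬PA)

module _ (G : Graph n) (adj? : ∀ u v → Dec (Adj G u v)) where

  dominating? : ∀ D → Dec (Dominating G D)
  dominating? D = all? λ v → ¬? (v ∈? D) →-dec any? λ u → u ∈? D ×-dec adj? u v

  minDominating? : ∀ D → Dec (MinDominating G D)
  minDominating? D =
    dominating? D ×-dec allSubsets? λ D′ → D′ ⊆? D →-dec dominating? D′ →-dec D′ ≟ₛ D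

Dominating-nonempty : (G : Graph (suc n)) → ∀ {D} → Dominating G D → Nonempty D
Dominating-nonempty G {D} dom with zero ∈? D
... | yes 0∈D = zero , 0∈D
... | no 0∉D with dom zero 0∉D
...   | u , u∈D , _ = u , u∈D

module _ (G : Graph n) where

  Dominating-⊆ : ∀ {D D′} → D ⊆ D′ → Dominating G D → Dominating G D′
  Dominating-⊆ D⊆D′ dom v v∉D′ with dom v (v∉D′ ∘ D⊆D′)
  ... | u , u∈D , u~v = u , D⊆D′ u∈D , u~v

  Dominating-⊆⁅⁆⇒∈ : ∀ {D u} → D ⊆ ⁅ u ⁆ → Dominating G D → u ∈ D
  Dominating-⊆⁅⁆⇒∈ {D} {u} D⊆ dom with u ∈? D
  ... | yes u∈D = u∈D
  ... | no u∉D with dom u u∉D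
  ...   | v , v∈D , _ = subst (_∈ D) (x∈⁅y⁆⇒x≡y u (D⊆ v∈D)) v∈D

  singleton-minDominating : ∀ {u} → Dominating G ⁅ u ⁆ → MinDominating G ⁅ u ⁆
  singleton-minDominating {u} dom = dom , minimal
    where
    minimal : ∀ D → D ⊆ ⁅ u ⁆ → Dominating G D → D ≡ ⁅ u ⁆
    minimal D D⊆ domD = ⊆-antisym D⊆ λ v∈ →
      subst (_∈ D) (≡.sym (x∈⁅y⁆⇒x≡y u v∈)) (Dominating-⊆⁅⁆⇒∈ D⊆ domD)

  pair-minDominating : (∀ u → ¬ Dominating G ⁅ u ⁆) →
                       ∀ {a b} → Dominating G (pair a b) → MinDominating G (pair a b)
  pair-minDominating no-vertex {a} {b} dom = dom , minimal
    where
    minimal : ∀ D → D ⊆ pair a b → Dominating G D → D ≡ pair a b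
    minimal D D⊆ domD with a ∈? D | b ∈? D
    ... | yes a∈D | yes b∈D = ⊆-antisym D⊆ (pair-⊆ a∈D b∈D)
    ... | no a∉D  | _       = ⊥-elim (no-vertex b (Dominating-⊆ (⊆-pair-∌ˡ a∉D D⊆) domD))
    ... | yes _   | no b∉D  = ⊥-elim (no-vertex a (Dominating-⊆ (⊆-pair-∌ʳ b∉D D⊆) domD))

  MinDominating-antichain : ∀ {A B} → MinDominating G A → MinDominating G B → A ⊆ B → A ≡ B
  MinDominating-antichain (domA , _) (_ , minimalB) A⊆B = minimalB _ A⊆B domA

module TwoElementCompletion
  (G : Graph n) (H : Family n) (H≋𝒟G : H ≋ 𝒟 G)
  (two-element : ∀ A → H A → ∣ A ∣ ≡ 2) (𝒰₃≤H : 𝒰₃ ≤ₕ H)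
  where

  no-dominating-vertex : ∀ u → ¬ Dominating G ⁅ u ⁆
  no-dominating-vertex u dom with ≡.trans (≡.sym (∣⁅x⁆∣≡1 u)) (two-element ⁅ u ⁆ u∈H)
    where
    u∈H : H ⁅ u ⁆
    u∈H = Equivalence.from (H≋𝒟G ⁅ u ⁆) (singleton-minDominating G dom)
  ... | ()

  dominating-pair∈H : ∀ {a b} → Dominating G (pair a b) → H (pair a b)
  dominating-pair∈H {a} {b} dom =
    Equivalence.from (H≋𝒟G (pair a b)) (pair-minDominating G no-dominating-vertex dom)

  pair∈H-dominates : ∀ {a b w} → H (pair a b) → w ∉ pair a b → Adj G a w ⊎ Adj G b w
  pair∈H-dominates {a} {b} {w} inH w∉ with proj₁ (Equivalence.to (H≋𝒟G (pair a b)) inH) w w∉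
  ... | u , u∈ , u~w with ∈-pair⁻ u∈
  ...   | inj₁ refl = inj₁ u~w
  ...   | inj₂ refl = inj₂ u~w

  triple-has-pair∈H : ∀ {x y z} → ∣ triple x y z ∣ ≡ 3 →
                      H (pair x y) ⊎ H (pair x z) ⊎ H (pair y z)
  triple-has-pair∈H {x} {y} {z} ∣xyz∣≡3 with 𝒰₃≤H (triple x y z) ∣xyz∣≡3
  ... | B , B∈H , B⊆ with ∣∣≡2∧⊆triple⇒pair {x = x} {y} {z} ∣xyz∣≡3 (two-element B B∈H) B⊆
  ...   | inj₁ refl = inj₁ B∈H
  ...   | inj₂ (inj₁ refl) = inj₂ (inj₁ B∈H)
  ...   | inj₂ (inj₂ refl) = inj₂ (inj₂ B∈H)

v₀ v₁ v₂ v₃ v₄ : Fin 5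
v₀ = # 0
v₁ = # 1
v₂ = # 2
v₃ = # 3
v₄ = # 4

fromTables : (f g : Vec (Fin 5) 5) →
             {True (all? λ i → lookup f (lookup g i) ≟ i)} →
             {True (all? λ i → lookup g (lookup f i) ≟ i)} →
             Permutation 5 5
fromTables f g {f∘g≗id} {g∘f≗id} =
  permutation (lookup f) (lookup g) (toWitness f∘g≗id) (toWitness g∘f≗id)

-- One relabelling σ for each of the twelve 5-cycles on Fin 5: its pentagram pairs are the edges of
-- that cycle.
relabellings : Vec (Permutation 5 5) 12
relabellings =
    fromTables (v₀ ∷ v₂ ∷ v₄ ∷ v₁ ∷ v₃ ∷ []) (v₀ ∷ v₃ ∷ v₁ ∷ v₄ ∷ v₂ ∷ [])
  ∷ fromTables (v₀ ∷ v₂ ∷ v₄ ∷ v₃ ∷ v₁ ∷ []) (v₀ ∷ v₄ ∷ v₁ ∷ v₃ ∷ v₂ ∷ [])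
  ∷ fromTables (v₀ ∷ v₂ ∷ v₁ ∷ v₄ ∷ v₃ ∷ []) (v₀ ∷ v₂ ∷ v₁ ∷ v₄ ∷ v₃ ∷ [])
  ∷ fromTables (v₀ ∷ v₂ ∷ v₃ ∷ v₄ ∷ v₁ ∷ []) (v₀ ∷ v₄ ∷ v₁ ∷ v₂ ∷ v₃ ∷ [])
  ∷ fromTables (v₀ ∷ v₂ ∷ v₁ ∷ v₃ ∷ v₄ ∷ []) (v₀ ∷ v₂ ∷ v₁ ∷ v₃ ∷ v₄ ∷ [])
  ∷ fromTables (v₀ ∷ v₂ ∷ v₃ ∷ v₁ ∷ v₄ ∷ []) (v₀ ∷ v₃ ∷ v₁ ∷ v₂ ∷ v₄ ∷ [])
  ∷ fromTables (v₀ ∷ v₄ ∷ v₂ ∷ v₁ ∷ v₃ ∷ []) (v₀ ∷ v₃ ∷ v₂ ∷ v₄ ∷ v₁ ∷ [])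
  ∷ fromTables (v₀ ∷ v₄ ∷ v₂ ∷ v₃ ∷ v₁ ∷ []) (v₀ ∷ v₄ ∷ v₂ ∷ v₃ ∷ v₁ ∷ [])
  ∷ fromTables (v₀ ∷ v₁ ∷ v₂ ∷ v₄ ∷ v₃ ∷ []) (v₀ ∷ v₁ ∷ v₂ ∷ v₄ ∷ v₃ ∷ [])
  ∷ fromTables (v₀ ∷ v₁ ∷ v₂ ∷ v₃ ∷ v₄ ∷ []) (v₀ ∷ v₁ ∷ v₂ ∷ v₃ ∷ v₄ ∷ [])
  ∷ fromTables (v₀ ∷ v₄ ∷ v₁ ∷ v₂ ∷ v₃ ∷ []) (v₀ ∷ v₂ ∷ v₃ ∷ v₄ ∷ v₁ ∷ [])
  ∷ fromTables (v₀ ∷ v₁ ∷ v₄ ∷ v₂ ∷ v₃ ∷ []) (v₀ ∷ v₁ ∷ v₃ ∷ v₄ ∷ v₂ ∷ [])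
  ∷ []

pentagramPair : Permutation 5 5 → Fin 5 → Subset 5
pentagramPair σ i = pair (σ ⟨$⟩ˡ i) (σ ⟨$⟩ˡ next5 (next5 i))

C₅Adj? : ∀ u v → Dec (C₅Adj u v)
C₅Adj? u v = map′ from to (v ≟ next5 u ⊎-dec u ≟ next5 v)
  where
  from : v ≡ next5 u ⊎ u ≡ next5 v → C₅Adj u v
  from (inj₁ refl) = fwd u
  from (inj₂ refl) = bwd v
  to : C₅Adj u v → v ≡ next5 u ⊎ u ≡ next5 v
  to (fwd _) = inj₁ refl
  to (bwd _) = inj₂ refl

relabelledC₅ : Permutation 5 5 → Graph 5
relabelledC₅ σ = record
  { Adj = λ u v → C₅Adj (σ ⟨$⟩ʳ u) (σ ⟨$⟩ʳ v)
  ; sym = C₅-sym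
  ; irrefl = C₅-irrefl
  }

relabelledC₅≅C₅ : ∀ σ → relabelledC₅ σ ≅ C₅
relabelledC₅≅C₅ σ = σ , λ _ _ → ⇔-refl

PentagramFacts : Permutation 5 5 → Set
PentagramFacts σ =
  (∀ i → MinDominating (relabelledC₅ σ) (pentagramPair σ i)) ×
  (∀ A → ∣ A ∣ ≡ 3 → ∃ λ i → pentagramPair σ i ⊆ A) ×
  (∀ A → Dominating (relabelledC₅ σ) A → ∃ λ i → pentagramPair σ i ⊆ A)

pentagramFacts? : ∀ σ → Dec (PentagramFacts σ)
pentagramFacts? σ =
  all? (λ i → minDominating? (relabelledC₅ σ) adj? (pentagramPair σ i)) ×-dec
  allSubsets? (λ A → ∣ A ∣ ℕ.≟ 3 →-dec any? λ i → pentagramPair σ i ⊆? A) ×-dec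
  allSubsets? (λ A → dominating? (relabelledC₅ σ) adj? A →-dec any? λ i → pentagramPair σ i ⊆? A)
  where
  adj? : ∀ u v → Dec (Adj (relabelledC₅ σ) u v)
  adj? u v = C₅Adj? (σ ⟨$⟩ʳ u) (σ ⟨$⟩ʳ v)

pentagramFacts : ∀ j → PentagramFacts (lookup relabellings j)
pentagramFacts = toWitness {a? = all? λ j → pentagramFacts? (lookup relabellings j)} tt

module _ (σ : Permutation 5 5) (facts : PentagramFacts σ) where

  private
    minDominating : ∀ i → MinDominating (relabelledC₅ σ) (pentagramPair σ i)
    minDominating = proj₁ facts

    three-set-⊇pentagramPair : ∀ A → ∣ A ∣ ≡ 3 → ∃ λ i → pentagramPair σ i ⊆ A
    three-set-⊇pentagramPair = proj₁ (proj₂ facts)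

    dominating-⊇pentagramPair : ∀ A → Dominating (relabelledC₅ σ) A → ∃ λ i → pentagramPair σ i ⊆ A
    dominating-⊇pentagramPair = proj₂ (proj₂ facts)

  𝒟-relabelledC₅-completion : IsDominationCompletion (𝒟 (relabelledC₅ σ))
  𝒟-relabelledC₅-completion = hypergraph , (relabelledC₅ σ , λ _ → ⇔-refl) , ground , 𝒰₃≤
    where
    hypergraph : IsHypergraph (𝒟 (relabelledC₅ σ))
    hypergraph = (pentagramPair σ zero , minDominating zero)
               , (λ _ → Dominating-nonempty (relabelledC₅ σ) ∘ proj₁)
               , (λ _ _ → MinDominating-antichain (relabelledC₅ σ))
    ground : HasGroundSet (𝒟 (relabelledC₅ σ))
    ground x = pentagramPair σ (σ ⟨$⟩ʳ x) , minDominating _ ,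
               subst (_∈ pentagramPair σ (σ ⟨$⟩ʳ x)) (inverseˡ σ) ∈-pairˡ
    𝒰₃≤ : 𝒰₃ ≤ₕ 𝒟 (relabelledC₅ σ)
    𝒰₃≤ A ∣A∣≡3 with three-set-⊇pentagramPair A ∣A∣≡3
    ... | i , ⊆A = pentagramPair σ i , minDominating i , ⊆A

  𝒟-relabelledC₅-≤ : ∀ {H} → (∀ i → H (pentagramPair σ i)) → 𝒟 (relabelledC₅ σ) ≤ₕ H
  𝒟-relabelledC₅-≤ inH A (domA , _) with dominating-⊇pentagramPair A domA
  ... | i , ⊆A = pentagramPair σ i , inH i , ⊆A

  ≋-𝒟-relabelledC₅ : ∀ {H} → (∀ H′ → IsDominationCompletion H′ → H′ ≤ₕ H → H′ ≋ H) →
                     (∀ i → H (pentagramPair σ i)) → H ≋ 𝒟 (relabelledC₅ σ)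
  ≋-𝒟-relabelledC₅ minimal inH A =
    ⇔-sym (minimal _ 𝒟-relabelledC₅-completion (𝒟-relabelledC₅-≤ inH) A)


record Knowledge (n : ℕ) : Set where
  field
    inH        : Vec (Subset n) n
    neighbours : Vec (Subset n) n
open Knowledge

link : Fin n → Fin n → Vec (Subset n) n → Vec (Subset n) n
link u v M = updateAt (updateAt M u (_∪ ⁅ v ⁆)) v (_∪ ⁅ u ⁆)

∈-updateAt-∪⁅⁆⁻ : ∀ {M : Vec (Subset n) n} {u v x y} →
                  y ∈ lookup (updateAt M u (_∪ ⁅ v ⁆)) x → y ∈ lookup M x ⊎ x ≡ u × y ≡ v
∈-updateAt-∪⁅⁆⁻ {M = M} {u} {v} {x} y∈ with x ≟ u
... | no x≢u = inj₁ (subst (_ ∈_) (Vec.lookup∘updateAt′ x u x≢u M) y∈)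
... | yes refl with x∈p∪q⁻ (lookup M x) ⁅ v ⁆ (subst (_ ∈_) (Vec.lookup∘updateAt x M) y∈)
...   | inj₁ y∈Mx = inj₁ y∈Mx
...   | inj₂ y∈v = inj₂ (refl , x∈⁅y⁆⇒x≡y v y∈v)

∈-link⁻ : ∀ {M : Vec (Subset n) n} {u v x y} →
          y ∈ lookup (link u v M) x → y ∈ lookup M x ⊎ x ≡ u × y ≡ v ⊎ x ≡ v × y ≡ u
∈-link⁻ {M = M} {u} {v} y∈ with ∈-updateAt-∪⁅⁆⁻ {M = updateAt M u (_∪ ⁅ v ⁆)} y∈
... | inj₂ new = inj₂ (inj₂ new)
... | inj₁ y∈ with ∈-updateAt-∪⁅⁆⁻ {M = M} y∈
...   | inj₁ old = inj₁ old
...   | inj₂ new = inj₂ (inj₁ new)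

noKnowledge : Knowledge n
noKnowledge = record { inH = replicate _ ⊥ ; neighbours = replicate _ ⊥ }

addPairInH : Fin n → Fin n → Knowledge n → Knowledge n
addPairInH a b k = record k { inH = link a b (inH k) }

addEdge : Fin n → Fin n → Knowledge n → Knowledge n
addEdge u v k = record k { neighbours = link u v (neighbours k) }

KnownDominatingPair : Knowledge n → Fin n → Fin n → Set
KnownDominatingPair k a b = pair a b ∪ (lookup (neighbours k) a ∪ lookup (neighbours k) b) ≡ ⊤

knownDominatingPair? : ∀ k (a b : Fin n) → Dec (KnownDominatingPair k a b)
knownDominatingPair? k a b = pair a b ∪ (lookup (neighbours k) a ∪ lookup (neighbours k) b) ≟ₛ ⊤

KnownInH : Knowledge n → Fin n → Fin n → Set
KnownInH k a b = b ∈ lookup (inH k) a ⊎ KnownDominatingPair k a b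

knownInH? : ∀ k (a b : Fin n) → Dec (KnownInH k a b)
knownInH? k a b = b ∈? lookup (inH k) a ⊎-dec knownDominatingPair? k a b

knownPentagram? : (k : Knowledge 5) (σ : Permutation 5 5) →
                  Dec (∀ i → KnownInH k (σ ⟨$⟩ˡ i) (σ ⟨$⟩ˡ next5 (next5 i)))
knownPentagram? k σ = all? λ i → knownInH? k (σ ⟨$⟩ˡ i) (σ ⟨$⟩ˡ next5 (next5 i))

data Certificate : Set where
  refute         : (u : Fin 5) → Certificate
  pentagram      : (j : Fin 12) → Certificate
  whichNeighbour : (a b w : Fin 5) → (ifA ifB : Certificate) → Certificate
  whichPair      : (x y z : Fin 5) → (ifXY ifXZ ifYZ : Certificate) → Certificate

Valid : Knowledge 5 → Certificate → Set
Valid k (refute u) = True (knownDominatingPair? k u u)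
Valid k (pentagram j) = True (knownPentagram? k (lookup relabellings j))
Valid k (whichNeighbour a b w ifA ifB) =
  True (knownInH? k a b) × True (¬? (w ∈? pair a b)) ×
  Valid (addEdge a w k) ifA × Valid (addEdge b w k) ifB
Valid k (whichPair x y z ifXY ifXZ ifYZ) =
  True (∣ triple x y z ∣ ℕ.≟ 3) ×
  Valid (addPairInH x y k) ifXY × Valid (addPairInH x z k) ifXZ × Valid (addPairInH y z k) ifYZ

certificate : Certificate
certificate =
  whichPair v₀ v₁ v₂ (whichPair v₂ v₃ v₄ (whichNeighbour v₀ v₁ v₄ (whichNeighbour v₂ v₃ v₁
  (whichNeighbour v₀ v₁ v₃ (whichNeighbour v₂ v₃ v₄ (whichPair v₁ v₃ v₄ (whichNeighbour v₁ v₃ v₄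
  (whichPair v₁ v₂ v₄ (pentagram (# 0)) (pentagram (# 5)) (pentagram (# 2))) (whichPair v₀ v₃ v₄
  (pentagram (# 4)) (pentagram (# 2)) (pentagram (# 3)))) (whichNeighbour v₁ v₄ v₃ (pentagram (#
  5)) (whichPair v₀ v₃ v₄ (pentagram (# 4)) (pentagram (# 2)) (pentagram (# 3)))) (whichNeighbour
  v₃ v₄ v₁ (pentagram (# 5)) (whichPair v₁ v₂ v₄ (pentagram (# 0)) (pentagram (# 5)) (pentagram (#
  2))))) (whichPair v₀ v₃ v₄ (pentagram (# 4)) (pentagram (# 2)) (pentagram (# 3))))
  (whichNeighbour v₂ v₃ v₀ (whichNeighbour v₂ v₃ v₄ (whichPair v₀ v₂ v₄ (pentagram (# 5))
  (pentagram (# 0)) (pentagram (# 1))) (pentagram (# 4))) (whichNeighbour v₂ v₃ v₄ (pentagram (#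
  5)) (whichPair v₀ v₃ v₄ (pentagram (# 4)) (pentagram (# 2)) (pentagram (# 3)))))) (whichNeighbour
  v₀ v₁ v₂ (whichNeighbour v₂ v₃ v₄ (whichPair v₀ v₂ v₄ (pentagram (# 5)) (pentagram (# 0))
  (pentagram (# 1))) (whichPair v₁ v₂ v₄ (whichNeighbour v₁ v₂ v₄ (whichPair v₁ v₃ v₄ (pentagram (#
  2)) (pentagram (# 4)) (pentagram (# 0))) (whichPair v₀ v₂ v₄ (pentagram (# 5)) (pentagram (# 0))
  (pentagram (# 1)))) (whichNeighbour v₁ v₄ v₂ (pentagram (# 4)) (whichPair v₀ v₂ v₄ (pentagram (#
  5)) (pentagram (# 0)) (pentagram (# 1)))) (whichNeighbour v₂ v₄ v₁ (pentagram (# 4)) (whichPair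
  v₁ v₃ v₄ (pentagram (# 2)) (pentagram (# 4)) (pentagram (# 0)))))) (whichNeighbour v₂ v₃ v₀
  (whichNeighbour v₂ v₃ v₄ (whichPair v₀ v₂ v₄ (pentagram (# 5)) (pentagram (# 0)) (pentagram (#
  1))) (pentagram (# 4))) (whichNeighbour v₂ v₃ v₄ (pentagram (# 5)) (whichPair v₀ v₃ v₄ (pentagram
  (# 4)) (pentagram (# 2)) (pentagram (# 3))))))) (whichNeighbour v₂ v₃ v₀ (whichNeighbour v₀ v₁ v₃
  (whichNeighbour v₂ v₃ v₁ (whichNeighbour v₂ v₃ v₄ (whichPair v₁ v₂ v₄ (pentagram (# 0))
  (pentagram (# 5)) (pentagram (# 2))) (pentagram (# 2))) (whichNeighbour v₂ v₃ v₄ (pentagram (#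
  0)) (whichPair v₁ v₃ v₄ (pentagram (# 2)) (pentagram (# 4)) (pentagram (# 0))))) (whichNeighbour
  v₂ v₃ v₄ (whichPair v₀ v₃ v₄ (whichNeighbour v₀ v₃ v₄ (whichPair v₀ v₂ v₄ (pentagram (# 5))
  (pentagram (# 0)) (pentagram (# 1))) (whichPair v₁ v₃ v₄ (pentagram (# 2)) (pentagram (# 4))
  (pentagram (# 0)))) (whichNeighbour v₀ v₄ v₃ (pentagram (# 0)) (whichPair v₁ v₃ v₄ (pentagram (#
  2)) (pentagram (# 4)) (pentagram (# 0)))) (whichNeighbour v₃ v₄ v₀ (pentagram (# 0)) (whichPair
  v₀ v₂ v₄ (pentagram (# 5)) (pentagram (# 0)) (pentagram (# 1))))) (whichPair v₁ v₃ v₄ (pentagram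
  (# 2)) (pentagram (# 4)) (pentagram (# 0))))) (whichNeighbour v₀ v₁ v₂ (whichNeighbour v₂ v₃ v₁
  (whichNeighbour v₂ v₃ v₄ (whichPair v₁ v₂ v₄ (pentagram (# 0)) (pentagram (# 5)) (pentagram (#
  2))) (pentagram (# 2))) (whichNeighbour v₂ v₃ v₄ (pentagram (# 0)) (whichPair v₁ v₃ v₄ (pentagram
  (# 2)) (pentagram (# 4)) (pentagram (# 0))))) (whichNeighbour v₂ v₃ v₄ (whichPair v₁ v₂ v₄
  (pentagram (# 0)) (pentagram (# 5)) (pentagram (# 2))) (whichPair v₀ v₂ v₄ (whichNeighbour v₀ v₂
  v₄ (whichPair v₀ v₃ v₄ (pentagram (# 4)) (pentagram (# 2)) (pentagram (# 3))) (whichPair v₁ v₂ v₄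
  (pentagram (# 0)) (pentagram (# 5)) (pentagram (# 2)))) (whichNeighbour v₀ v₄ v₂ (pentagram (#
  2)) (whichPair v₁ v₂ v₄ (pentagram (# 0)) (pentagram (# 5)) (pentagram (# 2)))) (whichNeighbour
  v₂ v₄ v₀ (pentagram (# 2)) (whichPair v₀ v₃ v₄ (pentagram (# 4)) (pentagram (# 2)) (pentagram (#
  3))))))))) (whichNeighbour v₀ v₁ v₃ (whichNeighbour v₂ v₄ v₁ (whichNeighbour v₀ v₁ v₄
  (whichNeighbour v₂ v₄ v₃ (whichPair v₁ v₃ v₄ (whichNeighbour v₁ v₃ v₄ (pentagram (# 3))
  (whichPair v₀ v₃ v₄ (pentagram (# 4)) (pentagram (# 2)) (pentagram (# 3)))) (whichNeighbour v₁ v₄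
  v₃ (whichPair v₁ v₂ v₃ (pentagram (# 1)) (pentagram (# 3)) (pentagram (# 4))) (whichPair v₀ v₃ v₄
  (pentagram (# 4)) (pentagram (# 2)) (pentagram (# 3)))) (whichNeighbour v₃ v₄ v₁ (whichPair v₁ v₂
  v₃ (pentagram (# 1)) (pentagram (# 3)) (pentagram (# 4))) (pentagram (# 3)))) (whichPair v₀ v₃ v₄
  (pentagram (# 4)) (pentagram (# 2)) (pentagram (# 3)))) (whichNeighbour v₂ v₄ v₀ (whichNeighbour
  v₂ v₄ v₃ (whichPair v₀ v₂ v₃ (pentagram (# 3)) (pentagram (# 1)) (pentagram (# 0))) (pentagram (#
  2))) (whichNeighbour v₂ v₄ v₃ (pentagram (# 3)) (whichPair v₀ v₃ v₄ (pentagram (# 4)) (pentagram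
  (# 2)) (pentagram (# 3)))))) (whichNeighbour v₀ v₁ v₂ (whichNeighbour v₂ v₄ v₃ (whichPair v₀ v₂
  v₃ (pentagram (# 3)) (pentagram (# 1)) (pentagram (# 0))) (whichPair v₁ v₂ v₃ (whichNeighbour v₁
  v₂ v₃ (whichPair v₁ v₃ v₄ (pentagram (# 2)) (pentagram (# 4)) (pentagram (# 0))) (whichPair v₀ v₂
  v₃ (pentagram (# 3)) (pentagram (# 1)) (pentagram (# 0)))) (whichNeighbour v₁ v₃ v₂ (pentagram (#
  2)) (whichPair v₀ v₂ v₃ (pentagram (# 3)) (pentagram (# 1)) (pentagram (# 0)))) (whichNeighbour
  v₂ v₃ v₁ (pentagram (# 2)) (whichPair v₁ v₃ v₄ (pentagram (# 2)) (pentagram (# 4)) (pentagram (#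
  0)))))) (whichNeighbour v₂ v₄ v₀ (whichNeighbour v₂ v₄ v₃ (whichPair v₀ v₂ v₃ (pentagram (# 3))
  (pentagram (# 1)) (pentagram (# 0))) (pentagram (# 2))) (whichNeighbour v₂ v₄ v₃ (pentagram (#
  3)) (whichPair v₀ v₃ v₄ (pentagram (# 4)) (pentagram (# 2)) (pentagram (# 3)))))))
  (whichNeighbour v₂ v₄ v₀ (whichNeighbour v₀ v₁ v₄ (whichNeighbour v₂ v₄ v₁ (whichNeighbour v₂ v₄
  v₃ (whichPair v₁ v₂ v₃ (pentagram (# 1)) (pentagram (# 3)) (pentagram (# 4))) (pentagram (# 4)))
  (whichNeighbour v₂ v₄ v₃ (pentagram (# 1)) (whichPair v₁ v₃ v₄ (pentagram (# 2)) (pentagram (#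
  4)) (pentagram (# 0))))) (whichNeighbour v₂ v₄ v₃ (whichPair v₀ v₃ v₄ (whichNeighbour v₀ v₃ v₄
  (pentagram (# 1)) (whichPair v₁ v₃ v₄ (pentagram (# 2)) (pentagram (# 4)) (pentagram (# 0))))
  (whichNeighbour v₀ v₄ v₃ (whichPair v₀ v₂ v₃ (pentagram (# 3)) (pentagram (# 1)) (pentagram (#
  0))) (whichPair v₁ v₃ v₄ (pentagram (# 2)) (pentagram (# 4)) (pentagram (# 0)))) (whichNeighbour
  v₃ v₄ v₀ (whichPair v₀ v₂ v₃ (pentagram (# 3)) (pentagram (# 1)) (pentagram (# 0))) (pentagram (#
  1)))) (whichPair v₁ v₃ v₄ (pentagram (# 2)) (pentagram (# 4)) (pentagram (# 0)))))
  (whichNeighbour v₀ v₁ v₂ (whichNeighbour v₂ v₄ v₁ (whichNeighbour v₂ v₄ v₃ (whichPair v₁ v₂ v₃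
  (pentagram (# 1)) (pentagram (# 3)) (pentagram (# 4))) (pentagram (# 4))) (whichNeighbour v₂ v₄
  v₃ (pentagram (# 1)) (whichPair v₁ v₃ v₄ (pentagram (# 2)) (pentagram (# 4)) (pentagram (# 0)))))
  (whichNeighbour v₂ v₄ v₃ (whichPair v₁ v₂ v₃ (pentagram (# 1)) (pentagram (# 3)) (pentagram (#
  4))) (whichPair v₀ v₂ v₃ (whichNeighbour v₀ v₂ v₃ (whichPair v₀ v₃ v₄ (pentagram (# 4))
  (pentagram (# 2)) (pentagram (# 3))) (whichPair v₁ v₂ v₃ (pentagram (# 1)) (pentagram (# 3))
  (pentagram (# 4)))) (whichNeighbour v₀ v₃ v₂ (pentagram (# 4)) (whichPair v₁ v₂ v₃ (pentagram (#
  1)) (pentagram (# 3)) (pentagram (# 4)))) (whichNeighbour v₂ v₃ v₀ (pentagram (# 4)) (whichPair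
  v₀ v₃ v₄ (pentagram (# 4)) (pentagram (# 2)) (pentagram (# 3))))))))) (whichNeighbour v₀ v₁ v₂
  (whichNeighbour v₃ v₄ v₁ (whichNeighbour v₀ v₁ v₄ (whichNeighbour v₃ v₄ v₂ (whichPair v₁ v₂ v₄
  (whichNeighbour v₁ v₂ v₄ (pentagram (# 1)) (whichPair v₀ v₂ v₄ (pentagram (# 5)) (pentagram (#
  0)) (pentagram (# 1)))) (whichNeighbour v₁ v₄ v₂ (whichPair v₁ v₂ v₃ (pentagram (# 1)) (pentagram
  (# 3)) (pentagram (# 4))) (whichPair v₀ v₂ v₄ (pentagram (# 5)) (pentagram (# 0)) (pentagram (#
  1)))) (whichNeighbour v₂ v₄ v₁ (whichPair v₁ v₂ v₃ (pentagram (# 1)) (pentagram (# 3)) (pentagram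
  (# 4))) (pentagram (# 1)))) (whichPair v₀ v₂ v₄ (pentagram (# 5)) (pentagram (# 0)) (pentagram (#
  1)))) (whichNeighbour v₃ v₄ v₀ (whichNeighbour v₃ v₄ v₂ (whichPair v₀ v₂ v₃ (pentagram (# 3))
  (pentagram (# 1)) (pentagram (# 0))) (pentagram (# 0))) (whichNeighbour v₃ v₄ v₂ (pentagram (#
  1)) (whichPair v₀ v₂ v₄ (pentagram (# 5)) (pentagram (# 0)) (pentagram (# 1)))))) (whichNeighbour
  v₀ v₁ v₃ (whichNeighbour v₃ v₄ v₂ (whichPair v₀ v₂ v₃ (pentagram (# 3)) (pentagram (# 1))
  (pentagram (# 0))) (whichPair v₁ v₂ v₃ (whichNeighbour v₁ v₂ v₃ (pentagram (# 0)) (whichPair v₀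
  v₂ v₃ (pentagram (# 3)) (pentagram (# 1)) (pentagram (# 0)))) (whichNeighbour v₁ v₃ v₂ (whichPair
  v₁ v₂ v₄ (pentagram (# 0)) (pentagram (# 5)) (pentagram (# 2))) (whichPair v₀ v₂ v₃ (pentagram (#
  3)) (pentagram (# 1)) (pentagram (# 0)))) (whichNeighbour v₂ v₃ v₁ (whichPair v₁ v₂ v₄ (pentagram
  (# 0)) (pentagram (# 5)) (pentagram (# 2))) (pentagram (# 0))))) (whichNeighbour v₃ v₄ v₀
  (whichNeighbour v₃ v₄ v₂ (whichPair v₀ v₂ v₃ (pentagram (# 3)) (pentagram (# 1)) (pentagram (#
  0))) (pentagram (# 0))) (whichNeighbour v₃ v₄ v₂ (pentagram (# 1)) (whichPair v₀ v₂ v₄ (pentagram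
  (# 5)) (pentagram (# 0)) (pentagram (# 1))))))) (whichNeighbour v₃ v₄ v₀ (whichNeighbour v₀ v₁ v₄
  (whichNeighbour v₃ v₄ v₁ (whichNeighbour v₃ v₄ v₂ (whichPair v₁ v₂ v₃ (pentagram (# 1))
  (pentagram (# 3)) (pentagram (# 4))) (pentagram (# 5))) (whichNeighbour v₃ v₄ v₂ (pentagram (#
  3)) (whichPair v₁ v₂ v₄ (pentagram (# 0)) (pentagram (# 5)) (pentagram (# 2))))) (whichNeighbour
  v₃ v₄ v₂ (whichPair v₀ v₂ v₄ (whichNeighbour v₀ v₂ v₄ (pentagram (# 3)) (whichPair v₁ v₂ v₄
  (pentagram (# 0)) (pentagram (# 5)) (pentagram (# 2)))) (whichNeighbour v₀ v₄ v₂ (whichPair v₀ v₂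
  v₃ (pentagram (# 3)) (pentagram (# 1)) (pentagram (# 0))) (whichPair v₁ v₂ v₄ (pentagram (# 0))
  (pentagram (# 5)) (pentagram (# 2)))) (whichNeighbour v₂ v₄ v₀ (whichPair v₀ v₂ v₃ (pentagram (#
  3)) (pentagram (# 1)) (pentagram (# 0))) (pentagram (# 3)))) (whichPair v₁ v₂ v₄ (pentagram (#
  0)) (pentagram (# 5)) (pentagram (# 2))))) (whichNeighbour v₀ v₁ v₃ (whichNeighbour v₃ v₄ v₁
  (whichNeighbour v₃ v₄ v₂ (whichPair v₁ v₂ v₃ (pentagram (# 1)) (pentagram (# 3)) (pentagram (#
  4))) (pentagram (# 5))) (whichNeighbour v₃ v₄ v₂ (pentagram (# 3)) (whichPair v₁ v₂ v₄ (pentagram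
  (# 0)) (pentagram (# 5)) (pentagram (# 2))))) (whichNeighbour v₃ v₄ v₂ (whichPair v₁ v₂ v₃
  (pentagram (# 1)) (pentagram (# 3)) (pentagram (# 4))) (whichPair v₀ v₂ v₃ (whichNeighbour v₀ v₂
  v₃ (pentagram (# 5)) (whichPair v₁ v₂ v₃ (pentagram (# 1)) (pentagram (# 3)) (pentagram (# 4))))
  (whichNeighbour v₀ v₃ v₂ (whichPair v₀ v₂ v₄ (pentagram (# 5)) (pentagram (# 0)) (pentagram (#
  1))) (whichPair v₁ v₂ v₃ (pentagram (# 1)) (pentagram (# 3)) (pentagram (# 4)))) (whichNeighbour
  v₂ v₃ v₀ (whichPair v₀ v₂ v₄ (pentagram (# 5)) (pentagram (# 0)) (pentagram (# 1))) (pentagram (#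
  5))))))))) (whichPair v₁ v₃ v₄ (whichNeighbour v₀ v₂ v₄ (whichNeighbour v₁ v₃ v₂ (whichNeighbour
  v₀ v₂ v₃ (whichNeighbour v₁ v₃ v₄ (whichPair v₂ v₃ v₄ (whichNeighbour v₂ v₃ v₄ (whichPair v₁ v₂
  v₄ (pentagram (# 0)) (pentagram (# 5)) (pentagram (# 2))) (whichPair v₀ v₃ v₄ (pentagram (# 4))
  (pentagram (# 2)) (pentagram (# 3)))) (whichNeighbour v₂ v₄ v₃ (pentagram (# 3)) (whichPair v₀ v₃
  v₄ (pentagram (# 4)) (pentagram (# 2)) (pentagram (# 3)))) (whichNeighbour v₃ v₄ v₂ (pentagram (#
  3)) (whichPair v₁ v₂ v₄ (pentagram (# 0)) (pentagram (# 5)) (pentagram (# 2))))) (whichPair v₀ v₃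
  v₄ (pentagram (# 4)) (pentagram (# 2)) (pentagram (# 3)))) (whichNeighbour v₁ v₃ v₀
  (whichNeighbour v₁ v₃ v₄ (whichPair v₀ v₁ v₄ (pentagram (# 1)) (pentagram (# 6)) (pentagram (#
  7))) (pentagram (# 9))) (whichNeighbour v₁ v₃ v₄ (pentagram (# 3)) (whichPair v₀ v₃ v₄ (pentagram
  (# 4)) (pentagram (# 2)) (pentagram (# 3)))))) (whichNeighbour v₀ v₂ v₁ (whichNeighbour v₁ v₃ v₄
  (whichPair v₀ v₁ v₄ (pentagram (# 1)) (pentagram (# 6)) (pentagram (# 7))) (whichPair v₁ v₂ v₄
  (whichNeighbour v₁ v₂ v₄ (whichPair v₀ v₁ v₄ (pentagram (# 1)) (pentagram (# 6)) (pentagram (#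
  7))) (whichPair v₂ v₃ v₄ (pentagram (# 8)) (pentagram (# 9)) (pentagram (# 6)))) (whichNeighbour
  v₁ v₄ v₂ (pentagram (# 9)) (whichPair v₂ v₃ v₄ (pentagram (# 8)) (pentagram (# 9)) (pentagram (#
  6)))) (whichNeighbour v₂ v₄ v₁ (pentagram (# 9)) (whichPair v₀ v₁ v₄ (pentagram (# 1)) (pentagram
  (# 6)) (pentagram (# 7)))))) (whichNeighbour v₁ v₃ v₀ (whichNeighbour v₁ v₃ v₄ (whichPair v₀ v₁
  v₄ (pentagram (# 1)) (pentagram (# 6)) (pentagram (# 7))) (pentagram (# 9))) (whichNeighbour v₁
  v₃ v₄ (pentagram (# 3)) (whichPair v₀ v₃ v₄ (pentagram (# 4)) (pentagram (# 2)) (pentagram (#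
  3))))))) (whichNeighbour v₁ v₃ v₀ (whichNeighbour v₀ v₂ v₃ (whichNeighbour v₁ v₃ v₂
  (whichNeighbour v₁ v₃ v₄ (whichPair v₁ v₂ v₄ (pentagram (# 0)) (pentagram (# 5)) (pentagram (#
  2))) (pentagram (# 8))) (whichNeighbour v₁ v₃ v₄ (pentagram (# 6)) (whichPair v₂ v₃ v₄ (pentagram
  (# 8)) (pentagram (# 9)) (pentagram (# 6))))) (whichNeighbour v₁ v₃ v₄ (whichPair v₀ v₃ v₄
  (whichNeighbour v₀ v₃ v₄ (whichPair v₀ v₁ v₄ (pentagram (# 1)) (pentagram (# 6)) (pentagram (#
  7))) (whichPair v₂ v₃ v₄ (pentagram (# 8)) (pentagram (# 9)) (pentagram (# 6)))) (whichNeighbour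
  v₀ v₄ v₃ (pentagram (# 6)) (whichPair v₂ v₃ v₄ (pentagram (# 8)) (pentagram (# 9)) (pentagram (#
  6)))) (whichNeighbour v₃ v₄ v₀ (pentagram (# 6)) (whichPair v₀ v₁ v₄ (pentagram (# 1)) (pentagram
  (# 6)) (pentagram (# 7))))) (whichPair v₂ v₃ v₄ (pentagram (# 8)) (pentagram (# 9)) (pentagram (#
  6))))) (whichNeighbour v₀ v₂ v₁ (whichNeighbour v₁ v₃ v₂ (whichNeighbour v₁ v₃ v₄ (whichPair v₁
  v₂ v₄ (pentagram (# 0)) (pentagram (# 5)) (pentagram (# 2))) (pentagram (# 8))) (whichNeighbour
  v₁ v₃ v₄ (pentagram (# 6)) (whichPair v₂ v₃ v₄ (pentagram (# 8)) (pentagram (# 9)) (pentagram (#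
  6))))) (whichNeighbour v₁ v₃ v₄ (whichPair v₁ v₂ v₄ (pentagram (# 0)) (pentagram (# 5))
  (pentagram (# 2))) (whichPair v₀ v₁ v₄ (whichNeighbour v₀ v₁ v₄ (whichPair v₀ v₃ v₄ (pentagram (#
  4)) (pentagram (# 2)) (pentagram (# 3))) (whichPair v₁ v₂ v₄ (pentagram (# 0)) (pentagram (# 5))
  (pentagram (# 2)))) (whichNeighbour v₀ v₄ v₁ (pentagram (# 8)) (whichPair v₁ v₂ v₄ (pentagram (#
  0)) (pentagram (# 5)) (pentagram (# 2)))) (whichNeighbour v₁ v₄ v₀ (pentagram (# 8)) (whichPair
  v₀ v₃ v₄ (pentagram (# 4)) (pentagram (# 2)) (pentagram (# 3))))))))) (whichNeighbour v₀ v₂ v₃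
  (whichNeighbour v₁ v₄ v₂ (whichNeighbour v₀ v₂ v₄ (whichNeighbour v₁ v₄ v₃ (whichPair v₂ v₃ v₄
  (whichNeighbour v₂ v₃ v₄ (pentagram (# 5)) (whichPair v₀ v₃ v₄ (pentagram (# 4)) (pentagram (#
  2)) (pentagram (# 3)))) (whichNeighbour v₂ v₄ v₃ (whichPair v₁ v₂ v₃ (pentagram (# 1)) (pentagram
  (# 3)) (pentagram (# 4))) (whichPair v₀ v₃ v₄ (pentagram (# 4)) (pentagram (# 2)) (pentagram (#
  3)))) (whichNeighbour v₃ v₄ v₂ (whichPair v₁ v₂ v₃ (pentagram (# 1)) (pentagram (# 3)) (pentagram
  (# 4))) (pentagram (# 5)))) (whichPair v₀ v₃ v₄ (pentagram (# 4)) (pentagram (# 2)) (pentagram (#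
  3)))) (whichNeighbour v₁ v₄ v₀ (whichNeighbour v₁ v₄ v₃ (whichPair v₀ v₁ v₃ (pentagram (# 0))
  (pentagram (# 7)) (pentagram (# 6))) (pentagram (# 8))) (whichNeighbour v₁ v₄ v₃ (pentagram (#
  5)) (whichPair v₀ v₃ v₄ (pentagram (# 4)) (pentagram (# 2)) (pentagram (# 3)))))) (whichNeighbour
  v₀ v₂ v₁ (whichNeighbour v₁ v₄ v₃ (whichPair v₀ v₁ v₃ (pentagram (# 0)) (pentagram (# 7))
  (pentagram (# 6))) (whichPair v₁ v₂ v₃ (whichNeighbour v₁ v₂ v₃ (whichPair v₀ v₁ v₃ (pentagram (#
  0)) (pentagram (# 7)) (pentagram (# 6))) (whichPair v₂ v₃ v₄ (pentagram (# 8)) (pentagram (# 9))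
  (pentagram (# 6)))) (whichNeighbour v₁ v₃ v₂ (pentagram (# 8)) (whichPair v₂ v₃ v₄ (pentagram (#
  8)) (pentagram (# 9)) (pentagram (# 6)))) (whichNeighbour v₂ v₃ v₁ (pentagram (# 8)) (whichPair
  v₀ v₁ v₃ (pentagram (# 0)) (pentagram (# 7)) (pentagram (# 6)))))) (whichNeighbour v₁ v₄ v₀
  (whichNeighbour v₁ v₄ v₃ (whichPair v₀ v₁ v₃ (pentagram (# 0)) (pentagram (# 7)) (pentagram (#
  6))) (pentagram (# 8))) (whichNeighbour v₁ v₄ v₃ (pentagram (# 5)) (whichPair v₀ v₃ v₄ (pentagram
  (# 4)) (pentagram (# 2)) (pentagram (# 3))))))) (whichNeighbour v₁ v₄ v₀ (whichNeighbour v₀ v₂ v₄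
  (whichNeighbour v₁ v₄ v₂ (whichNeighbour v₁ v₄ v₃ (whichPair v₁ v₂ v₃ (pentagram (# 1))
  (pentagram (# 3)) (pentagram (# 4))) (pentagram (# 9))) (whichNeighbour v₁ v₄ v₃ (pentagram (#
  7)) (whichPair v₂ v₃ v₄ (pentagram (# 8)) (pentagram (# 9)) (pentagram (# 6))))) (whichNeighbour
  v₁ v₄ v₃ (whichPair v₀ v₃ v₄ (whichNeighbour v₀ v₃ v₄ (pentagram (# 7)) (whichPair v₂ v₃ v₄
  (pentagram (# 8)) (pentagram (# 9)) (pentagram (# 6)))) (whichNeighbour v₀ v₄ v₃ (whichPair v₀ v₁
  v₃ (pentagram (# 0)) (pentagram (# 7)) (pentagram (# 6))) (whichPair v₂ v₃ v₄ (pentagram (# 8))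
  (pentagram (# 9)) (pentagram (# 6)))) (whichNeighbour v₃ v₄ v₀ (whichPair v₀ v₁ v₃ (pentagram (#
  0)) (pentagram (# 7)) (pentagram (# 6))) (pentagram (# 7)))) (whichPair v₂ v₃ v₄ (pentagram (#
  8)) (pentagram (# 9)) (pentagram (# 6))))) (whichNeighbour v₀ v₂ v₁ (whichNeighbour v₁ v₄ v₂
  (whichNeighbour v₁ v₄ v₃ (whichPair v₁ v₂ v₃ (pentagram (# 1)) (pentagram (# 3)) (pentagram (#
  4))) (pentagram (# 9))) (whichNeighbour v₁ v₄ v₃ (pentagram (# 7)) (whichPair v₂ v₃ v₄ (pentagram
  (# 8)) (pentagram (# 9)) (pentagram (# 6))))) (whichNeighbour v₁ v₄ v₃ (whichPair v₁ v₂ v₃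
  (pentagram (# 1)) (pentagram (# 3)) (pentagram (# 4))) (whichPair v₀ v₁ v₃ (whichNeighbour v₀ v₁
  v₃ (whichPair v₀ v₃ v₄ (pentagram (# 4)) (pentagram (# 2)) (pentagram (# 3))) (whichPair v₁ v₂ v₃
  (pentagram (# 1)) (pentagram (# 3)) (pentagram (# 4)))) (whichNeighbour v₀ v₃ v₁ (pentagram (#
  9)) (whichPair v₁ v₂ v₃ (pentagram (# 1)) (pentagram (# 3)) (pentagram (# 4)))) (whichNeighbour
  v₁ v₃ v₀ (pentagram (# 9)) (whichPair v₀ v₃ v₄ (pentagram (# 4)) (pentagram (# 2)) (pentagram (#
  3))))))))) (whichNeighbour v₀ v₂ v₁ (whichNeighbour v₃ v₄ v₁ (whichNeighbour v₀ v₂ v₄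
  (whichNeighbour v₃ v₄ v₂ (whichPair v₁ v₂ v₄ (whichNeighbour v₁ v₂ v₄ (whichPair v₀ v₁ v₄
  (pentagram (# 1)) (pentagram (# 6)) (pentagram (# 7))) (pentagram (# 7))) (whichNeighbour v₁ v₄
  v₂ (whichPair v₁ v₂ v₃ (pentagram (# 1)) (pentagram (# 3)) (pentagram (# 4))) (pentagram (# 7)))
  (whichNeighbour v₂ v₄ v₁ (whichPair v₁ v₂ v₃ (pentagram (# 1)) (pentagram (# 3)) (pentagram (#
  4))) (whichPair v₀ v₁ v₄ (pentagram (# 1)) (pentagram (# 6)) (pentagram (# 7))))) (whichNeighbour
  v₀ v₂ v₃ (whichPair v₀ v₁ v₃ (pentagram (# 0)) (pentagram (# 7)) (pentagram (# 6))) (pentagram (#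
  7)))) (whichNeighbour v₀ v₂ v₃ (whichPair v₀ v₁ v₃ (pentagram (# 0)) (pentagram (# 7)) (pentagram
  (# 6))) (whichNeighbour v₃ v₄ v₀ (whichPair v₀ v₁ v₃ (pentagram (# 0)) (pentagram (# 7))
  (pentagram (# 6))) (pentagram (# 7))))) (whichNeighbour v₀ v₂ v₃ (whichNeighbour v₃ v₄ v₂
  (whichNeighbour v₀ v₂ v₄ (whichPair v₀ v₁ v₄ (pentagram (# 1)) (pentagram (# 6)) (pentagram (#
  7))) (pentagram (# 6))) (whichPair v₁ v₂ v₃ (whichNeighbour v₁ v₂ v₃ (whichPair v₀ v₁ v₃
  (pentagram (# 0)) (pentagram (# 7)) (pentagram (# 6))) (pentagram (# 6))) (whichNeighbour v₁ v₃
  v₂ (whichPair v₁ v₂ v₄ (pentagram (# 0)) (pentagram (# 5)) (pentagram (# 2))) (pentagram (# 6)))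
  (whichNeighbour v₂ v₃ v₁ (whichPair v₁ v₂ v₄ (pentagram (# 0)) (pentagram (# 5)) (pentagram (#
  2))) (whichPair v₀ v₁ v₃ (pentagram (# 0)) (pentagram (# 7)) (pentagram (# 6))))))
  (whichNeighbour v₀ v₂ v₄ (whichPair v₀ v₁ v₄ (pentagram (# 1)) (pentagram (# 6)) (pentagram (#
  7))) (whichNeighbour v₃ v₄ v₀ (pentagram (# 6)) (whichPair v₀ v₁ v₄ (pentagram (# 1)) (pentagram
  (# 6)) (pentagram (# 7))))))) (whichNeighbour v₃ v₄ v₀ (whichNeighbour v₀ v₂ v₄ (whichNeighbour
  v₃ v₄ v₁ (whichNeighbour v₃ v₄ v₂ (whichPair v₁ v₂ v₃ (pentagram (# 1)) (pentagram (# 3))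
  (pentagram (# 4))) (pentagram (# 5))) (whichNeighbour v₃ v₄ v₂ (pentagram (# 3)) (whichPair v₁ v₂
  v₄ (pentagram (# 0)) (pentagram (# 5)) (pentagram (# 2))))) (whichNeighbour v₃ v₄ v₁ (whichPair
  v₀ v₁ v₄ (whichNeighbour v₀ v₁ v₄ (pentagram (# 5)) (whichPair v₁ v₂ v₄ (pentagram (# 0))
  (pentagram (# 5)) (pentagram (# 2)))) (whichNeighbour v₀ v₄ v₁ (whichPair v₀ v₁ v₃ (pentagram (#
  0)) (pentagram (# 7)) (pentagram (# 6))) (whichPair v₁ v₂ v₄ (pentagram (# 0)) (pentagram (# 5))
  (pentagram (# 2)))) (whichNeighbour v₁ v₄ v₀ (whichPair v₀ v₁ v₃ (pentagram (# 0)) (pentagram (#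
  7)) (pentagram (# 6))) (pentagram (# 5)))) (whichPair v₁ v₂ v₄ (pentagram (# 0)) (pentagram (#
  5)) (pentagram (# 2))))) (whichNeighbour v₀ v₂ v₃ (whichNeighbour v₃ v₄ v₁ (whichNeighbour v₃ v₄
  v₂ (whichPair v₁ v₂ v₃ (pentagram (# 1)) (pentagram (# 3)) (pentagram (# 4))) (pentagram (# 5)))
  (whichNeighbour v₃ v₄ v₂ (pentagram (# 3)) (whichPair v₁ v₂ v₄ (pentagram (# 0)) (pentagram (#
  5)) (pentagram (# 2))))) (whichNeighbour v₃ v₄ v₁ (whichPair v₁ v₂ v₃ (pentagram (# 1))
  (pentagram (# 3)) (pentagram (# 4))) (whichPair v₀ v₁ v₃ (whichNeighbour v₀ v₁ v₃ (pentagram (#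
  3)) (whichPair v₁ v₂ v₃ (pentagram (# 1)) (pentagram (# 3)) (pentagram (# 4)))) (whichNeighbour
  v₀ v₃ v₁ (whichPair v₀ v₁ v₄ (pentagram (# 1)) (pentagram (# 6)) (pentagram (# 7))) (whichPair v₁
  v₂ v₃ (pentagram (# 1)) (pentagram (# 3)) (pentagram (# 4)))) (whichNeighbour v₁ v₃ v₀ (whichPair
  v₀ v₁ v₄ (pentagram (# 1)) (pentagram (# 6)) (pentagram (# 7))) (pentagram (# 3)))))))))
  (whichPair v₀ v₃ v₄ (whichNeighbour v₀ v₃ v₄ (whichNeighbour v₁ v₂ v₃ (whichNeighbour v₀ v₃ v₂
  (whichNeighbour v₁ v₂ v₄ (whichPair v₂ v₃ v₄ (whichNeighbour v₂ v₃ v₄ (whichPair v₀ v₂ v₄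
  (pentagram (# 5)) (pentagram (# 0)) (pentagram (# 1))) (whichPair v₁ v₃ v₄ (pentagram (# 2))
  (pentagram (# 4)) (pentagram (# 0)))) (whichNeighbour v₂ v₄ v₃ (pentagram (# 1)) (whichPair v₁ v₃
  v₄ (pentagram (# 2)) (pentagram (# 4)) (pentagram (# 0)))) (whichNeighbour v₃ v₄ v₂ (pentagram (#
  1)) (whichPair v₀ v₂ v₄ (pentagram (# 5)) (pentagram (# 0)) (pentagram (# 1))))) (whichPair v₀ v₂
  v₄ (pentagram (# 5)) (pentagram (# 0)) (pentagram (# 1)))) (whichNeighbour v₁ v₂ v₀
  (whichNeighbour v₁ v₂ v₄ (whichPair v₀ v₁ v₄ (pentagram (# 1)) (pentagram (# 6)) (pentagram (#
  7))) (pentagram (# 7))) (whichNeighbour v₁ v₂ v₄ (pentagram (# 1)) (whichPair v₀ v₂ v₄ (pentagram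
  (# 5)) (pentagram (# 0)) (pentagram (# 1)))))) (whichNeighbour v₀ v₃ v₁ (whichNeighbour v₁ v₂ v₄
  (whichPair v₀ v₁ v₄ (pentagram (# 1)) (pentagram (# 6)) (pentagram (# 7))) (whichPair v₁ v₃ v₄
  (whichNeighbour v₁ v₃ v₄ (whichPair v₀ v₁ v₄ (pentagram (# 1)) (pentagram (# 6)) (pentagram (#
  7))) (whichPair v₂ v₃ v₄ (pentagram (# 8)) (pentagram (# 9)) (pentagram (# 6)))) (whichNeighbour
  v₁ v₄ v₃ (pentagram (# 7)) (whichPair v₂ v₃ v₄ (pentagram (# 8)) (pentagram (# 9)) (pentagram (#
  6)))) (whichNeighbour v₃ v₄ v₁ (pentagram (# 7)) (whichPair v₀ v₁ v₄ (pentagram (# 1)) (pentagram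
  (# 6)) (pentagram (# 7)))))) (whichNeighbour v₁ v₂ v₀ (whichNeighbour v₁ v₂ v₄ (whichPair v₀ v₁
  v₄ (pentagram (# 1)) (pentagram (# 6)) (pentagram (# 7))) (pentagram (# 7))) (whichNeighbour v₁
  v₂ v₄ (pentagram (# 1)) (whichPair v₀ v₂ v₄ (pentagram (# 5)) (pentagram (# 0)) (pentagram (#
  1))))))) (whichNeighbour v₁ v₂ v₀ (whichNeighbour v₀ v₃ v₂ (whichNeighbour v₁ v₂ v₃
  (whichNeighbour v₁ v₂ v₄ (whichPair v₁ v₃ v₄ (pentagram (# 2)) (pentagram (# 4)) (pentagram (#
  0))) (pentagram (# 11))) (whichNeighbour v₁ v₂ v₄ (pentagram (# 10)) (whichPair v₂ v₃ v₄
  (pentagram (# 8)) (pentagram (# 9)) (pentagram (# 6))))) (whichNeighbour v₁ v₂ v₄ (whichPair v₀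
  v₂ v₄ (whichNeighbour v₀ v₂ v₄ (whichPair v₀ v₁ v₄ (pentagram (# 1)) (pentagram (# 6)) (pentagram
  (# 7))) (whichPair v₂ v₃ v₄ (pentagram (# 8)) (pentagram (# 9)) (pentagram (# 6))))
  (whichNeighbour v₀ v₄ v₂ (pentagram (# 10)) (whichPair v₂ v₃ v₄ (pentagram (# 8)) (pentagram (#
  9)) (pentagram (# 6)))) (whichNeighbour v₂ v₄ v₀ (pentagram (# 10)) (whichPair v₀ v₁ v₄
  (pentagram (# 1)) (pentagram (# 6)) (pentagram (# 7))))) (whichPair v₂ v₃ v₄ (pentagram (# 8))
  (pentagram (# 9)) (pentagram (# 6))))) (whichNeighbour v₀ v₃ v₁ (whichNeighbour v₁ v₂ v₃
  (whichNeighbour v₁ v₂ v₄ (whichPair v₁ v₃ v₄ (pentagram (# 2)) (pentagram (# 4)) (pentagram (#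
  0))) (pentagram (# 11))) (whichNeighbour v₁ v₂ v₄ (pentagram (# 10)) (whichPair v₂ v₃ v₄
  (pentagram (# 8)) (pentagram (# 9)) (pentagram (# 6))))) (whichNeighbour v₁ v₂ v₄ (whichPair v₁
  v₃ v₄ (pentagram (# 2)) (pentagram (# 4)) (pentagram (# 0))) (whichPair v₀ v₁ v₄ (whichNeighbour
  v₀ v₁ v₄ (whichPair v₀ v₂ v₄ (pentagram (# 5)) (pentagram (# 0)) (pentagram (# 1))) (whichPair v₁
  v₃ v₄ (pentagram (# 2)) (pentagram (# 4)) (pentagram (# 0)))) (whichNeighbour v₀ v₄ v₁ (pentagram
  (# 11)) (whichPair v₁ v₃ v₄ (pentagram (# 2)) (pentagram (# 4)) (pentagram (# 0))))
  (whichNeighbour v₁ v₄ v₀ (pentagram (# 11)) (whichPair v₀ v₂ v₄ (pentagram (# 5)) (pentagram (#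
  0)) (pentagram (# 1))))))))) (whichNeighbour v₀ v₄ v₃ (whichNeighbour v₁ v₂ v₃ (whichNeighbour v₀
  v₄ v₂ (whichNeighbour v₁ v₂ v₄ (whichPair v₂ v₃ v₄ (whichNeighbour v₂ v₃ v₄ (pentagram (# 0))
  (whichPair v₁ v₃ v₄ (pentagram (# 2)) (pentagram (# 4)) (pentagram (# 0)))) (whichNeighbour v₂ v₄
  v₃ (whichPair v₀ v₂ v₃ (pentagram (# 3)) (pentagram (# 1)) (pentagram (# 0))) (whichPair v₁ v₃ v₄
  (pentagram (# 2)) (pentagram (# 4)) (pentagram (# 0)))) (whichNeighbour v₃ v₄ v₂ (whichPair v₀ v₂
  v₃ (pentagram (# 3)) (pentagram (# 1)) (pentagram (# 0))) (pentagram (# 0)))) (whichNeighbour v₀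
  v₄ v₁ (whichPair v₀ v₁ v₃ (pentagram (# 0)) (pentagram (# 7)) (pentagram (# 6))) (pentagram (#
  0)))) (whichNeighbour v₀ v₄ v₁ (whichPair v₀ v₁ v₃ (pentagram (# 0)) (pentagram (# 7)) (pentagram
  (# 6))) (whichNeighbour v₁ v₂ v₀ (whichPair v₀ v₁ v₃ (pentagram (# 0)) (pentagram (# 7))
  (pentagram (# 6))) (pentagram (# 0))))) (whichNeighbour v₀ v₄ v₁ (whichNeighbour v₁ v₂ v₄
  (whichNeighbour v₀ v₄ v₂ (whichPair v₀ v₂ v₃ (pentagram (# 3)) (pentagram (# 1)) (pentagram (#
  0))) (pentagram (# 6))) (whichPair v₁ v₃ v₄ (whichNeighbour v₁ v₃ v₄ (pentagram (# 6)) (whichPair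
  v₂ v₃ v₄ (pentagram (# 8)) (pentagram (# 9)) (pentagram (# 6)))) (whichNeighbour v₁ v₄ v₃
  (whichPair v₀ v₁ v₃ (pentagram (# 0)) (pentagram (# 7)) (pentagram (# 6))) (whichPair v₂ v₃ v₄
  (pentagram (# 8)) (pentagram (# 9)) (pentagram (# 6)))) (whichNeighbour v₃ v₄ v₁ (whichPair v₀ v₁
  v₃ (pentagram (# 0)) (pentagram (# 7)) (pentagram (# 6))) (pentagram (# 6))))) (whichNeighbour v₀
  v₄ v₂ (whichPair v₀ v₂ v₃ (pentagram (# 3)) (pentagram (# 1)) (pentagram (# 0))) (whichNeighbour
  v₁ v₂ v₀ (pentagram (# 6)) (whichPair v₀ v₂ v₃ (pentagram (# 3)) (pentagram (# 1)) (pentagram (#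
  0))))))) (whichNeighbour v₁ v₂ v₀ (whichNeighbour v₀ v₄ v₂ (whichNeighbour v₁ v₂ v₃
  (whichNeighbour v₁ v₂ v₄ (whichPair v₁ v₃ v₄ (pentagram (# 2)) (pentagram (# 4)) (pentagram (#
  0))) (pentagram (# 11))) (whichNeighbour v₁ v₂ v₄ (pentagram (# 10)) (whichPair v₂ v₃ v₄
  (pentagram (# 8)) (pentagram (# 9)) (pentagram (# 6))))) (whichNeighbour v₁ v₂ v₃ (whichPair v₀
  v₂ v₃ (whichNeighbour v₀ v₂ v₃ (whichPair v₀ v₁ v₃ (pentagram (# 0)) (pentagram (# 7)) (pentagram
  (# 6))) (whichPair v₂ v₃ v₄ (pentagram (# 8)) (pentagram (# 9)) (pentagram (# 6))))
  (whichNeighbour v₀ v₃ v₂ (pentagram (# 11)) (whichPair v₂ v₃ v₄ (pentagram (# 8)) (pentagram (#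
  9)) (pentagram (# 6)))) (whichNeighbour v₂ v₃ v₀ (pentagram (# 11)) (whichPair v₀ v₁ v₃
  (pentagram (# 0)) (pentagram (# 7)) (pentagram (# 6))))) (whichPair v₂ v₃ v₄ (pentagram (# 8))
  (pentagram (# 9)) (pentagram (# 6))))) (whichNeighbour v₀ v₄ v₁ (whichNeighbour v₁ v₂ v₃
  (whichNeighbour v₁ v₂ v₄ (whichPair v₁ v₃ v₄ (pentagram (# 2)) (pentagram (# 4)) (pentagram (#
  0))) (pentagram (# 11))) (whichNeighbour v₁ v₂ v₄ (pentagram (# 10)) (whichPair v₂ v₃ v₄
  (pentagram (# 8)) (pentagram (# 9)) (pentagram (# 6))))) (whichNeighbour v₁ v₂ v₃ (whichPair v₁
  v₃ v₄ (pentagram (# 2)) (pentagram (# 4)) (pentagram (# 0))) (whichPair v₀ v₁ v₃ (whichNeighbour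
  v₀ v₁ v₃ (whichPair v₀ v₂ v₃ (pentagram (# 3)) (pentagram (# 1)) (pentagram (# 0))) (whichPair v₁
  v₃ v₄ (pentagram (# 2)) (pentagram (# 4)) (pentagram (# 0)))) (whichNeighbour v₀ v₃ v₁ (pentagram
  (# 10)) (whichPair v₁ v₃ v₄ (pentagram (# 2)) (pentagram (# 4)) (pentagram (# 0))))
  (whichNeighbour v₁ v₃ v₀ (pentagram (# 10)) (whichPair v₀ v₂ v₃ (pentagram (# 3)) (pentagram (#
  1)) (pentagram (# 0))))))))) (whichNeighbour v₁ v₂ v₀ (whichNeighbour v₃ v₄ v₀ (whichNeighbour v₁
  v₂ v₄ (whichNeighbour v₃ v₄ v₂ (whichPair v₀ v₂ v₄ (whichNeighbour v₀ v₂ v₄ (whichPair v₀ v₁ v₄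
  (pentagram (# 1)) (pentagram (# 6)) (pentagram (# 7))) (pentagram (# 6))) (whichNeighbour v₀ v₄
  v₂ (whichPair v₀ v₂ v₃ (pentagram (# 3)) (pentagram (# 1)) (pentagram (# 0))) (pentagram (# 6)))
  (whichNeighbour v₂ v₄ v₀ (whichPair v₀ v₂ v₃ (pentagram (# 3)) (pentagram (# 1)) (pentagram (#
  0))) (whichPair v₀ v₁ v₄ (pentagram (# 1)) (pentagram (# 6)) (pentagram (# 7))))) (whichNeighbour
  v₁ v₂ v₃ (whichPair v₀ v₁ v₃ (pentagram (# 0)) (pentagram (# 7)) (pentagram (# 6))) (pentagram (#
  6)))) (whichNeighbour v₁ v₂ v₃ (whichPair v₀ v₁ v₃ (pentagram (# 0)) (pentagram (# 7)) (pentagram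
  (# 6))) (whichNeighbour v₃ v₄ v₁ (whichPair v₀ v₁ v₃ (pentagram (# 0)) (pentagram (# 7))
  (pentagram (# 6))) (pentagram (# 6))))) (whichNeighbour v₁ v₂ v₃ (whichNeighbour v₃ v₄ v₂
  (whichNeighbour v₁ v₂ v₄ (whichPair v₀ v₁ v₄ (pentagram (# 1)) (pentagram (# 6)) (pentagram (#
  7))) (pentagram (# 7))) (whichPair v₀ v₂ v₃ (whichNeighbour v₀ v₂ v₃ (whichPair v₀ v₁ v₃
  (pentagram (# 0)) (pentagram (# 7)) (pentagram (# 6))) (pentagram (# 7))) (whichNeighbour v₀ v₃
  v₂ (whichPair v₀ v₂ v₄ (pentagram (# 5)) (pentagram (# 0)) (pentagram (# 1))) (pentagram (# 7)))
  (whichNeighbour v₂ v₃ v₀ (whichPair v₀ v₂ v₄ (pentagram (# 5)) (pentagram (# 0)) (pentagram (#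
  1))) (whichPair v₀ v₁ v₃ (pentagram (# 0)) (pentagram (# 7)) (pentagram (# 6))))))
  (whichNeighbour v₁ v₂ v₄ (whichPair v₀ v₁ v₄ (pentagram (# 1)) (pentagram (# 6)) (pentagram (#
  7))) (whichNeighbour v₃ v₄ v₁ (pentagram (# 7)) (whichPair v₀ v₁ v₄ (pentagram (# 1)) (pentagram
  (# 6)) (pentagram (# 7))))))) (whichNeighbour v₃ v₄ v₀ (whichNeighbour v₁ v₂ v₄ (whichNeighbour
  v₁ v₂ v₃ (whichNeighbour v₃ v₄ v₂ (whichPair v₀ v₂ v₃ (pentagram (# 3)) (pentagram (# 1))
  (pentagram (# 0))) (pentagram (# 0))) (whichPair v₀ v₂ v₃ (pentagram (# 3)) (pentagram (# 1))
  (pentagram (# 0)))) (whichNeighbour v₃ v₄ v₁ (whichPair v₀ v₁ v₄ (whichNeighbour v₀ v₁ v₄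
  (whichPair v₀ v₂ v₄ (pentagram (# 5)) (pentagram (# 0)) (pentagram (# 1))) (pentagram (# 0)))
  (whichNeighbour v₀ v₄ v₁ (whichPair v₀ v₁ v₃ (pentagram (# 0)) (pentagram (# 7)) (pentagram (#
  6))) (pentagram (# 0))) (whichNeighbour v₁ v₄ v₀ (whichPair v₀ v₁ v₃ (pentagram (# 0)) (pentagram
  (# 7)) (pentagram (# 6))) (whichPair v₀ v₂ v₄ (pentagram (# 5)) (pentagram (# 0)) (pentagram (#
  1))))) (whichNeighbour v₁ v₂ v₃ (pentagram (# 0)) (whichPair v₀ v₂ v₃ (pentagram (# 3))
  (pentagram (# 1)) (pentagram (# 0)))))) (whichNeighbour v₁ v₂ v₃ (whichNeighbour v₁ v₂ v₄
  (whichNeighbour v₃ v₄ v₂ (pentagram (# 1)) (whichPair v₀ v₂ v₄ (pentagram (# 5)) (pentagram (#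
  0)) (pentagram (# 1)))) (whichPair v₀ v₂ v₄ (pentagram (# 5)) (pentagram (# 0)) (pentagram (#
  1)))) (whichNeighbour v₃ v₄ v₁ (whichNeighbour v₁ v₂ v₄ (pentagram (# 1)) (whichPair v₀ v₂ v₄
  (pentagram (# 5)) (pentagram (# 0)) (pentagram (# 1)))) (whichPair v₀ v₁ v₃ (whichNeighbour v₀ v₁
  v₃ (whichPair v₀ v₂ v₃ (pentagram (# 3)) (pentagram (# 1)) (pentagram (# 0))) (pentagram (# 1)))
  (whichNeighbour v₀ v₃ v₁ (whichPair v₀ v₁ v₄ (pentagram (# 1)) (pentagram (# 6)) (pentagram (#
  7))) (pentagram (# 1))) (whichNeighbour v₁ v₃ v₀ (whichPair v₀ v₁ v₄ (pentagram (# 1)) (pentagram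
  (# 6)) (pentagram (# 7))) (whichPair v₀ v₂ v₃ (pentagram (# 3)) (pentagram (# 1)) (pentagram (#
  0))))))))))

-- Valid noKnowledge certificate evaluates to a product of ⊤s.
certificate-valid : Valid noKnowledge certificate
certificate-valid = _

module Soundness (G : Graph n) (H : Family n) where

  record Sound (k : Knowledge n) : Set where
    field
      inH-sound        : ∀ {a b} → b ∈ lookup (inH k) a → H (pair a b)
      neighbours-sound : ∀ {u v} → v ∈ lookup (neighbours k) u → Adj G u v
  open Sound

  noKnowledge-sound : Sound noKnowledge
  noKnowledge-sound = record
    { inH-sound        = λ {a} b∈ → ⊥-elim (∉⊥ (subst (_ ∈_) (Vec.lookup-replicate a ⊥) b∈))
    ; neighbours-sound = λ {u} v∈ → ⊥-elim (∉⊥ (subst (_ ∈_) (Vec.lookup-replicate u ⊥) v∈))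
    }

  addPairInH-sound : ∀ {k} a b → Sound k → H (pair a b) → Sound (addPairInH a b k)
  addPairInH-sound {k} a b sound ab∈H =
    record { inH-sound = inH-sound′ ; neighbours-sound = neighbours-sound sound }
    where
    inH-sound′ : ∀ {x y} → y ∈ lookup (link a b (inH k)) x → H (pair x y)
    inH-sound′ y∈ with ∈-link⁻ {M = inH k} y∈
    ... | inj₁ old = inH-sound sound old
    ... | inj₂ (inj₁ (refl , refl)) = ab∈H
    ... | inj₂ (inj₂ (refl , refl)) = subst H pair-comm ab∈H

  addEdge-sound : ∀ {k u v} → Sound k → Adj G u v → Sound (addEdge u v k)
  addEdge-sound {k} {u} {v} sound u~v =
    record { inH-sound = inH-sound sound ; neighbours-sound = neighbours-sound′ }
    where
    neighbours-sound′ : ∀ {x y} → y ∈ lookup (link u v (neighbours k)) x → Adj G x y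
    neighbours-sound′ y∈ with ∈-link⁻ {M = neighbours k} y∈
    ... | inj₁ old = neighbours-sound sound old
    ... | inj₂ (inj₁ (refl , refl)) = u~v
    ... | inj₂ (inj₂ (refl , refl)) = Graph.sym G u~v

  KnownDominatingPair⇒Dominating : ∀ {k a b} → Sound k → KnownDominatingPair k a b →
                                   Dominating G (pair a b)
  KnownDominatingPair⇒Dominating {k} {a} {b} sound dom v v∉
    with x∈p∪q⁻ (pair a b) _ (subst (v ∈_) (≡.sym dom) ∈⊤)
  ... | inj₁ v∈ab = ⊥-elim (v∉ v∈ab)
  ... | inj₂ v∈N with x∈p∪q⁻ (lookup (neighbours k) a) _ v∈N
  ...   | inj₁ v∈Na = a , ∈-pairˡ , neighbours-sound sound v∈Na
  ...   | inj₂ v∈Nb = b , ∈-pairʳ , neighbours-sound sound v∈Nb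

module _ (G : Graph 5) (H : Family 5) (H≋𝒟G : H ≋ 𝒟 G)
         (two-element : ∀ A → H A → ∣ A ∣ ≡ 2) (𝒰₃≤H : 𝒰₃ ≤ₕ H)
  where

  open TwoElementCompletion G H H≋𝒟G two-element 𝒰₃≤H
  open Soundness G H

  knownInH-sound : ∀ {k a b} → Sound k → KnownInH k a b → H (pair a b)
  knownInH-sound sound (inj₁ b∈) = Sound.inH-sound sound b∈
  knownInH-sound sound (inj₂ dom) = dominating-pair∈H (KnownDominatingPair⇒Dominating sound dom)

  valid-sound : ∀ k c → Sound k → Valid k c →
                ∃ λ j → ∀ i → H (pentagramPair (lookup relabellings j) i)
  valid-sound _ (refute u) sound dom =
    ⊥-elim (no-dominating-vertex u
      (Dominating-⊆ G pair-self-⊆ (KnownDominatingPair⇒Dominating sound (toWitness dom))))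
  valid-sound _ (pentagram j) sound known = j , λ i → knownInH-sound sound (toWitness known i)
  valid-sound _ (whichNeighbour a b w ifA ifB) sound (ab∈H , w∉ab , validA , validB)
    with pair∈H-dominates (knownInH-sound sound (toWitness ab∈H)) (toWitness w∉ab)
  ... | inj₁ a~w = valid-sound _ ifA (addEdge-sound sound a~w) validA
  ... | inj₂ b~w = valid-sound _ ifB (addEdge-sound sound b~w) validB
  valid-sound _ (whichPair x y z ifXY ifXZ ifYZ) sound (∣xyz∣≡3 , validXY , validXZ , validYZ)
    with triple-has-pair∈H (toWitness ∣xyz∣≡3)
  ... | inj₁ xy∈H = valid-sound _ ifXY (addPairInH-sound x y sound xy∈H) validXY
  ... | inj₂ (inj₁ xz∈H) = valid-sound _ ifXZ (addPairInH-sound x z sound xz∈H) validXZ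
  ... | inj₂ (inj₂ yz∈H) = valid-sound _ ifYZ (addPairInH-sound y z sound yz∈H) validYZ

  pentagram-in-H : ∃ λ j → ∀ i → H (pentagramPair (lookup relabellings j) i)
  pentagram-in-H = valid-sound noKnowledge certificate noKnowledge-sound certificate-valid

lemma4p18 : (H : Family 5) → IsMinimalDominationCompletion H
    → (∀ A → H A → ∣ A ∣ ≡ 2)
    → Σ (Graph 5) λ G → (H ≋ 𝒟 G) × (G ≅ C₅)
lemma4p18 H ((_ , (G , H≋𝒟G) , _ , 𝒰₃≤H) , minimal) two-element =
  relabelledC₅-conclusion (pentagram-in-H G H H≋𝒟G two-element 𝒰₃≤H)
  where
  relabelledC₅-conclusion : (∃ λ j → ∀ i → H (pentagramPair (lookup relabellings j) i)) →
                            Σ (Graph 5) λ G → (H ≋ 𝒟 G) × (G ≅ C₅)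
  relabelledC₅-conclusion (j , inH) =
    relabelledC₅ σ , ≋-𝒟-relabelledC₅ σ (pentagramFacts j) minimal inH , relabelledC₅≅C₅ σ
    where
    σ : Permutation 5 5
    σ = lookup relabellings j
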